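{- Let $r\ge1$, let $\mu,\nu$ be partitions with at most $r$ parts such that $\mu\subseteq\nu$, and let $I,J\subseteq[r]$ be subsets of cardinality $d$. If $\mathrm{itop}(I)\subseteq\mathrm{itop}(J)$, then $\mu_{I^c}\subseteq\nu_{J^c}$.
   Context: $[r]=\{1,\dots,r\}$; $I^c$ is the complement of $I$ in $[r]$. For $I=\{i_1<\cdots<i_d\}$, $\mathrm{itop}(I)=(i_d-d\ge\cdots\ge i_1-1)$. For a partition $\mu=(\mu_1\ge\cdots\ge\mu_r)$ (padded with zeros) and $S=\{s_1<\cdots<s_m\}\subseteq[r]$, $\mu_S$ denotes the partition $(\mu_{s_1}\ge\cdots\ge\mu_{s_m})$. Containment $\subseteq$ of partitions means containment of Young diagrams, i.e. componentwise $\le$. -}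

module Defs where

open import Data.Nat using (ℕ; zero; suc; _∸_; _≤_)
open import Data.Bool using (Bool; true; false)
open import Data.List using (List; []; _∷_; map; zipWith; reverse; length; upTo)
open import Data.Vec using (Vec; []; _∷_; lookup; toList)
open import Data.Fin using (Fin)
import Data.Fin as F
open import Data.Fin.Subset using (Subset)

-- A partition with at most r parts: a weakly decreasing vector of length r
-- (padded with zeros).
IsPartition : ∀ {r} → Vec ℕ r → Set
IsPartition {r} μ = ∀ (i j : Fin r) → i F.≤ j → lookup μ j ≤ lookup μ i

entry : List ℕ → ℕ → ℕ
entry []       _       = 0
entry (x ∷ xs) zero    = x
entry (x ∷ xs) (suc k) = entry xs k

-- Containment of Young diagrams: componentwise ≤ (after zero padding).
_⊆ₚ_ : List ℕ → List ℕ → Set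
λ₁ ⊆ₚ λ₂ = ∀ (k : ℕ) → entry λ₁ k ≤ entry λ₂ k

-- Elements of a subset of [r], as 1-based indices in increasing order.
positions : ∀ {r} → Subset r → List ℕ
positions []          = []
positions (true ∷ p)  = 1 ∷ map suc (positions p)
positions (false ∷ p) = map suc (positions p)

-- itop(I) = (i_d - d ≥ ⋯ ≥ i_1 - 1) for I = {i_1 < ⋯ < i_d}.
itop : ∀ {r} → Subset r → List ℕ
itop I = reverse (zipWith _∸_ (positions I) (map suc (upTo (length (positions I)))))

restrict : ∀ {r} → Vec ℕ r → Subset r → List ℕ
restrict []       []          = []
restrict (x ∷ μ)  (true ∷ S)  = x ∷ restrict μ S
restrict (x ∷ μ)  (false ∷ S) = restrict μ S

-- Write I = {i₁ < ⋯ < i_d}. Since i_k - k is order-reflecting on increasing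
-- sequences, itop(I) ⊆ itop(J) says exactly that i_k ≤ j_k for every k, i.e.
-- scanning [r] from the left, I is always at least as advanced as J. Swapping the
-- roles of "in" and "out" turns this into the same statement for J^c against I^c,
-- so the k-th element b_k of J^c is at most the k-th element a_k of I^c. As μ is
-- weakly decreasing and μ ⊆ ν, we get μ_{a_k} ≤ μ_{b_k} ≤ ν_{b_k}.
module Submission where

open import Defs
open import Data.Nat using (ℕ; zero; suc; pred; _∸_; _⊓_; _≤_; z≤n; s≤s; s≤s⁻¹)
open import Data.Nat.Properties using (≤-refl; ≤-trans; m≤n⇒m≤1+n; +-monoˡ-≤; m∸n+n≡m)
open import Data.Bool using (true; false)
open import Data.List using (List; []; _∷_; map; zipWith; reverse; length; upTo; replicate; _++_)
open import Data.List.Properties using (map-∘; map-upTo; length-map; length-zipWith; length-reverse; reverse-involutive)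
open import Data.List.Relation.Binary.Pointwise using (Pointwise; []; _∷_; map⁺; map⁻; reverse⁺; Pointwise-length)
import Data.List.Relation.Binary.Pointwise as Pointwise
open import Data.Vec using (Vec; []; _∷_; toList)
import Data.Fin as F
open import Data.Fin.Subset using (Subset; ∁; ∣_∣)
open import Data.Empty using (⊥-elim)
open import Relation.Nullary using (¬_)
open import Relation.Binary.PropositionalEquality using (_≡_; refl; sym; trans; cong; subst; subst₂)

private
  variable
    n c : ℕ
    x : ℕ
    xs ys zs : List ℕ

Pointwise⇒⊆ₚ : Pointwise _≤_ xs ys → xs ⊆ₚ ys
Pointwise⇒⊆ₚ []       _       = z≤n
Pointwise⇒⊆ₚ (p ∷ ps) zero    = p
Pointwise⇒⊆ₚ (p ∷ ps) (suc k) = Pointwise⇒⊆ₚ ps k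

⊆ₚ⇒Pointwise : length xs ≡ length ys → xs ⊆ₚ ys → Pointwise _≤_ xs ys
⊆ₚ⇒Pointwise {[]}     {[]}     _ _ = []
⊆ₚ⇒Pointwise {x ∷ xs} {y ∷ ys} e h = h 0 ∷ ⊆ₚ⇒Pointwise (cong pred e) (λ k → h (suc k))

reverse-⊆ₚ⇒Pointwise : length xs ≡ length ys → reverse xs ⊆ₚ reverse ys → Pointwise _≤_ xs ys
reverse-⊆ₚ⇒Pointwise {xs} {ys} e h =
  subst₂ (Pointwise _≤_) (reverse-involutive xs) (reverse-involutive ys)
    (reverse⁺ (⊆ₚ⇒Pointwise {reverse xs} {reverse ys}
      (trans (length-reverse xs) (trans e (sym (length-reverse ys)))) h))

Pointwise-∸-reflects-≤ : Pointwise _≤_ zs xs → Pointwise _≤_ zs ys →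
  Pointwise _≤_ (zipWith _∸_ xs zs) (zipWith _∸_ ys zs) → Pointwise _≤_ xs ys
Pointwise-∸-reflects-≤ [] [] [] = []
Pointwise-∸-reflects-≤ (z≤x ∷ p) (z≤y ∷ q) (d ∷ r) =
  subst₂ _≤_ (m∸n+n≡m z≤x) (m∸n+n≡m z≤y) (+-monoˡ-≤ _ d) ∷ Pointwise-∸-reflects-≤ p q r

∸-reflects-⊆ₚ : Pointwise _≤_ zs xs → Pointwise _≤_ zs ys →
  reverse (zipWith _∸_ xs zs) ⊆ₚ reverse (zipWith _∸_ ys zs) → Pointwise _≤_ xs ys
∸-reflects-⊆ₚ {zs} {xs} {ys} p q h = Pointwise-∸-reflects-≤ p q (reverse-⊆ₚ⇒Pointwise lengths h)
  where
  lengths : length (zipWith _∸_ xs zs) ≡ length (zipWith _∸_ ys zs)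
  lengths = trans (length-zipWith _∸_ xs zs)
    (trans (cong (_⊓ length zs) (trans (sym (Pointwise-length p)) (Pointwise-length q)))
      (sym (length-zipWith _∸_ ys zs)))

Pointwise-suc⁺ : Pointwise _≤_ xs ys → Pointwise _≤_ (map suc xs) (map suc ys)
Pointwise-suc⁺ p = map⁺ suc suc (Pointwise.map s≤s p)

Pointwise-suc⁻ : Pointwise _≤_ (map suc xs) (map suc ys) → Pointwise _≤_ xs ys
Pointwise-suc⁻ p = Pointwise.map s≤s⁻¹ (map⁻ suc suc p)

Pointwise-sucʳ : Pointwise _≤_ xs ys → Pointwise _≤_ xs (map suc ys)
Pointwise-sucʳ []       = []
Pointwise-sucʳ (p ∷ ps) = m≤n⇒m≤1+n p ∷ Pointwise-sucʳ ps

indices : Subset n → List ℕ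
indices []          = []
indices (true ∷ S)  = 0 ∷ map suc (indices S)
indices (false ∷ S) = map suc (indices S)

positions≡map-suc-indices : (S : Subset n) → positions S ≡ map suc (indices S)
positions≡map-suc-indices []          = refl
positions≡map-suc-indices (true ∷ S)  = cong (λ P → 1 ∷ map suc P) (positions≡map-suc-indices S)
positions≡map-suc-indices (false ∷ S) = cong (map suc) (positions≡map-suc-indices S)

length-indices : (S : Subset n) → length (indices S) ≡ ∣ S ∣
length-indices []          = refl
length-indices (true ∷ S)  = cong suc (trans (length-map suc (indices S)) (length-indices S))
length-indices (false ∷ S) = trans (length-map suc (indices S)) (length-indices S)

length-positions : (S : Subset n) → length (positions S) ≡ ∣ S ∣
length-positions S = trans (cong length (positions≡map-suc-indices S))
  (trans (length-map suc (indices S)) (length-indices S))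

upTo-≤-indices : (S : Subset n) → Pointwise _≤_ (upTo ∣ S ∣) (indices S)
upTo-≤-indices []          = []
upTo-≤-indices (true ∷ S)  =
  z≤n ∷ subst (λ Z → Pointwise _≤_ Z (map suc (indices S))) (map-upTo suc ∣ S ∣)
          (Pointwise-suc⁺ (upTo-≤-indices S))
upTo-≤-indices (false ∷ S) = Pointwise-sucʳ (upTo-≤-indices S)

itop≡ : (S : Subset n) {d : ℕ} → ∣ S ∣ ≡ d →
  itop S ≡ reverse (zipWith _∸_ (positions S) (map suc (upTo d)))
itop≡ S e = cong (λ d → reverse (zipWith _∸_ (positions S) (map suc (upTo d))))
  (trans (length-positions S) e)

upTo-<-positions : (S : Subset n) {d : ℕ} → ∣ S ∣ ≡ d →
  Pointwise _≤_ (map suc (upTo d)) (positions S)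
upTo-<-positions S refl =
  subst (Pointwise _≤_ (map suc (upTo ∣ S ∣))) (sym (positions≡map-suc-indices S))
    (Pointwise-suc⁺ (upTo-≤-indices S))

itop-⊆ₚ⇒positions-≤ : (I J : Subset n) {d : ℕ} → ∣ I ∣ ≡ d → ∣ J ∣ ≡ d → itop I ⊆ₚ itop J →
  Pointwise _≤_ (positions I) (positions J)
itop-⊆ₚ⇒positions-≤ I J eI eJ h = ∸-reflects-⊆ₚ (upTo-<-positions I eI) (upTo-<-positions J eJ)
  (subst₂ _⊆ₚ_ (itop≡ I eI) (itop≡ J eJ) h)

positions-≤⇒indices-≤ : (I J : Subset n) → Pointwise _≤_ (positions I) (positions J) →
  Pointwise _≤_ (indices I) (indices J)
positions-≤⇒indices-≤ I J p = Pointwise-suc⁻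
  (subst₂ (Pointwise _≤_) (positions≡map-suc-indices I) (positions≡map-suc-indices J) p)

-- Scanning I and J from the left, c is the number of elements of I already read
-- but not yet matched with an element of J; in Precedes⇒indices-≤ these are the
-- zeros of replicate c 0.
data Precedes : ℕ → Subset n → Subset n → Set where
  []      : Precedes 0 [] []
  both    : ∀ {I J : Subset n} → Precedes c I J → Precedes c (true ∷ I) (true ∷ J)
  neither : ∀ {I J : Subset n} → Precedes c I J → Precedes c (false ∷ I) (false ∷ J)
  push    : ∀ {I J : Subset n} → Precedes (suc c) I J → Precedes c (true ∷ I) (false ∷ J)
  pop     : ∀ {I J : Subset n} → Precedes c I J → Precedes (suc c) (false ∷ I) (true ∷ J)

Precedes-∁ : {I J : Subset n} → Precedes c I J → Precedes c (∁ J) (∁ I)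
Precedes-∁ []          = []
Precedes-∁ (both p)    = neither (Precedes-∁ p)
Precedes-∁ (neither p) = both (Precedes-∁ p)
Precedes-∁ (push p)    = push (Precedes-∁ p)
Precedes-∁ (pop p)     = pop (Precedes-∁ p)

replicate-++-∷ : ∀ c (xs : List ℕ) → replicate c x ++ x ∷ xs ≡ x ∷ replicate c x ++ xs
replicate-++-∷ zero    xs = refl
replicate-++-∷ (suc c) xs = cong (_ ∷_) (replicate-++-∷ c xs)

padded-suc⁺ : ∀ c → Pointwise _≤_ (replicate c 0 ++ xs) ys →
  Pointwise _≤_ (replicate c 0 ++ map suc xs) (map suc ys)
padded-suc⁺                 zero    p       = Pointwise-suc⁺ p
padded-suc⁺ {ys = _ ∷ _} (suc c) (_ ∷ p) = z≤n ∷ padded-suc⁺ c p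

padded-suc⁻ : ∀ c → Pointwise _≤_ (replicate c 0 ++ map suc xs) (map suc ys) →
  Pointwise _≤_ (replicate c 0 ++ xs) ys
padded-suc⁻                 zero    p       = Pointwise-suc⁻ p
padded-suc⁻ {ys = _ ∷ _} (suc c) (_ ∷ p) = z≤n ∷ padded-suc⁻ c p

padded-push⁺ : ∀ c → Pointwise _≤_ (replicate (suc c) 0 ++ xs) ys →
  Pointwise _≤_ (replicate c 0 ++ 0 ∷ map suc xs) (map suc ys)
padded-push⁺ c p = subst (λ zs → Pointwise _≤_ zs _) (sym (replicate-++-∷ c _)) (padded-suc⁺ (suc c) p)

padded-push⁻ : ∀ c → Pointwise _≤_ (replicate c 0 ++ 0 ∷ map suc xs) (map suc ys) →
  Pointwise _≤_ (replicate (suc c) 0 ++ xs) ys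
padded-push⁻ c p = padded-suc⁻ (suc c) (subst (λ zs → Pointwise _≤_ zs _) (replicate-++-∷ c _) p)

Precedes⇒indices-≤ : {I J : Subset n} → Precedes c I J →
  Pointwise _≤_ (replicate c 0 ++ indices I) (indices J)
Precedes⇒indices-≤ []                    = []
Precedes⇒indices-≤ (both {c = zero} p)  = z≤n ∷ padded-suc⁺ 0 (Precedes⇒indices-≤ p)
Precedes⇒indices-≤ (both {c = suc c} p) = z≤n ∷ padded-push⁺ c (Precedes⇒indices-≤ p)
Precedes⇒indices-≤ (neither {c = c} p)  = padded-suc⁺ c (Precedes⇒indices-≤ p)
Precedes⇒indices-≤ (push {c = c} p)     = padded-push⁺ c (Precedes⇒indices-≤ p)
Precedes⇒indices-≤ (pop {c = c} p)      = z≤n ∷ padded-suc⁺ c (Precedes⇒indices-≤ p)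

map-suc≰0∷ : ∀ xs → ¬ Pointwise _≤_ (map suc xs) (0 ∷ ys)
map-suc≰0∷ [] ()
map-suc≰0∷ (_ ∷ _) (() ∷ _)

indices-≤⇒Precedes : ∀ c (I J : Subset n) →
  Pointwise _≤_ (replicate c 0 ++ indices I) (indices J) → Precedes c I J
indices-≤⇒Precedes zero    []          []          _       = []
indices-≤⇒Precedes (suc c) []          []          ()
indices-≤⇒Precedes zero    (true ∷ I)  (true ∷ J)  (_ ∷ p) = both (indices-≤⇒Precedes 0 I J (padded-suc⁻ 0 p))
indices-≤⇒Precedes (suc c) (true ∷ I)  (true ∷ J)  (_ ∷ p) = both (indices-≤⇒Precedes (suc c) I J (padded-push⁻ c p))
indices-≤⇒Precedes c       (true ∷ I)  (false ∷ J) p       = push (indices-≤⇒Precedes (suc c) I J (padded-push⁻ c p))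
indices-≤⇒Precedes zero    (false ∷ I) (true ∷ J)  p       = ⊥-elim (map-suc≰0∷ (indices I) p)
indices-≤⇒Precedes (suc c) (false ∷ I) (true ∷ J)  (_ ∷ p) = pop (indices-≤⇒Precedes c I J (padded-suc⁻ c p))
indices-≤⇒Precedes c       (false ∷ I) (false ∷ J) p       = neither (indices-≤⇒Precedes c I J (padded-suc⁻ c p))

indices-≤⇒indices-∁-≥ : (I J : Subset n) → Pointwise _≤_ (indices I) (indices J) →
  Pointwise _≤_ (indices (∁ J)) (indices (∁ I))
indices-≤⇒indices-∁-≥ I J p = Precedes⇒indices-≤ (Precedes-∁ (indices-≤⇒Precedes 0 I J p))

IsPartition-tail : {μ : Vec ℕ n} → IsPartition (x ∷ μ) → IsPartition μ
IsPartition-tail P i j i≤j = P (F.suc i) (F.suc j) (s≤s i≤j)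

entry-head≤ : {μ : Vec ℕ n} → IsPartition (x ∷ μ) → entry (toList μ) 0 ≤ x
entry-head≤ {μ = []}    P = z≤n
entry-head≤ {μ = _ ∷ _} P = P F.zero (F.suc F.zero) z≤n

entry-antitone : (μ : Vec ℕ n) → IsPartition μ → ∀ {i j} → i ≤ j →
  entry (toList μ) j ≤ entry (toList μ) i
entry-antitone []      P _                 = z≤n
entry-antitone (_ ∷ μ) P {j = zero}  z≤n   = ≤-refl
entry-antitone (_ ∷ μ) P {j = suc j} z≤n   = ≤-trans (entry-antitone μ (IsPartition-tail P) z≤n) (entry-head≤ P)
entry-antitone (_ ∷ μ) P (s≤s i≤j)         = entry-antitone μ (IsPartition-tail P) i≤j

restrict≡map-entry : (μ : Vec ℕ n) (S : Subset n) → restrict μ S ≡ map (entry (toList μ)) (indices S)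
restrict≡map-entry []      []          = refl
restrict≡map-entry (y ∷ μ) (true ∷ S)  = cong (y ∷_) (trans (restrict≡map-entry μ S) (map-∘ (indices S)))
restrict≡map-entry (y ∷ μ) (false ∷ S) = trans (restrict≡map-entry μ S) (map-∘ (indices S))

restrict-⊆ₚ : (μ ν : Vec ℕ n) (S T : Subset n) → IsPartition μ → toList μ ⊆ₚ toList ν →
  Pointwise _≤_ (indices T) (indices S) → restrict μ S ⊆ₚ restrict ν T
restrict-⊆ₚ μ ν S T P μ⊆ν p = Pointwise⇒⊆ₚ
  (subst₂ (Pointwise _≤_) (sym (restrict≡map-entry μ S)) (sym (restrict≡map-entry ν T))
    (map⁺ _ _ (Pointwise.map (λ b≤a → ≤-trans (entry-antitone μ P b≤a) (μ⊆ν _))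
      (Pointwise.symmetric (λ b≤a → b≤a) p))))

lemma2p7 : (r : ℕ) → 1 ≤ r → (μ ν : Vec ℕ r) → IsPartition μ → IsPartition ν →
    toList μ ⊆ₚ toList ν → (d : ℕ) → (I J : Subset r) → ∣ I ∣ ≡ d → ∣ J ∣ ≡ d →
    itop I ⊆ₚ itop J → restrict μ (∁ I) ⊆ₚ restrict ν (∁ J)
lemma2p7 r _ μ ν Pμ _ μ⊆ν d I J ∣I∣≡d ∣J∣≡d itopI⊆itopJ =
  restrict-⊆ₚ μ ν (∁ I) (∁ J) Pμ μ⊆ν (indices-≤⇒indices-∁-≥ I J
    (positions-≤⇒indices-≤ I J (itop-⊆ₚ⇒positions-≤ I J ∣I∣≡d ∣J∣≡d itopI⊆itopJ)))
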